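{- In the epoch setting, for every $i\in[\rho]$ and every $I\in\mathcal{I}$, there is an agent in $A^{(i)}$ whose set of visited states during the roundabout process of the $i$-th epoch contains $I$.
   Context: Let $n\ge2$, $k\ge1$ and $\Delta\ge1$ be integers. Let $\mathcal{G}=\langle G_1,\dots,G_L\rangle$ be a temporal graph (a sequence of graphs, the snapshots, on a common vertex set $V$ with $|V|=n$), and let $T$ be a spanning tree of its underlying graph (the union of all snapshots). A snapshot is $k$-edge-deficient w.r.t. $T$ if it contains all but at most $k$ edges of $T$. DFS tour. Fix a DFS tour of $T$ from a root back to the root traversing each edge twice, written $(v_1,\dots,v_N,v_{N+1})$ with $v_{N+1}=v_1$, $N=2(n-1)$, and $e_q=\{v_q,v_{q+1}\}$. For $i,j\in[N]$ the circular interval $[i,j]$ is $\{i,\dots,j\}$ if $i\le j$ and $\{i,\dots,N,1,\dots,j\}$ if $i>j$; $[i,j)=[i,j]\setminus\{j\}$. Roundabout process on a sequence $H_1,\dots,H_t$ of graphs, each $k$-edge-deficient w.r.t. $T$. Agents $a_1,\dots,a_N$ start at $s_p(0)=p$, and $A(0)=\{a_1,\dots,a_N\}$. At step $u=1,\dots,t$: (1) each agent in state $q$ moves to $(q\bmod N)+1$ if $e_q\in E(H_u)$, and stays otherwise; (2) with $D_p(u)=[p,s_p(u)]$ the visited states, agents are removed one at a time from $A(u-1)$ whenever their $D_p(u)$ is covered by the union of the $D$'s of the other currently remaining agents, until none remains; the result is $A(u)$. Epoch setting. Let $t=\lfloor N/(2k)\rfloor$ and $\rho=\lceil 18k\ln(6k)\rceil$.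 An initial part of $[L]$ is partitioned into $\rho$ consecutive time intervals (epochs), each containing at least $\Delta+n/k$ snapshots that are $k$-edge-deficient w.r.t. $T$. The first $\Delta$ time steps of an epoch form its repositioning part and the rest its roundabout part; the roundabout part contains at least $t$ such snapshots. In epoch $i$, the roundabout process (with arbitrary removal choices) is run on the first $t$ snapshots of its roundabout part that are $k$-edge-deficient w.r.t. $T$. Let $A^{(i)}$ be the set of agents active after step $t$ in epoch $i$, and $S^{(i)}\subseteq[N]$ the set of their initial states. Let $\bigcup_{i\in[\rho]}S^{(i)}=\{m_1<\dots<m_d\}$. Set $I_j=[m_j,m_{j+1})$ for $j\in[d-1]$, $I_d=[m_d,m_1)$, and $\mathcal{I}=\{I_1,\dots,I_d\}$. -}

module Defs where

open import Data.Nat using (ℕ; zero; suc; _+_; _*_; _∸_; _^_; _≤_; _<_; _/_; _!; _<ᵇ_; _≤ᵇ_)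
open import Data.Nat.Properties using (_!≢0)
open import Data.Fin using (Fin; toℕ; fromℕ<) renaming (zero to fzero)
open import Data.Fin.Subset using (Subset; _∈_; _∉_; _-_; ⊤)
open import Data.Bool using (Bool; true; false; _∧_; _∨_; not; if_then_else_)
open import Data.Nat.ListAction using (sum)
open import Data.List using (List; []; _∷_; map; allFin; upTo; filter; take; length; foldl)
open import Data.Product using (Σ; ∃; _×_; _,_)
open import Data.Sum using (_⊎_)
open import Relation.Nullary using (¬_; yes; no)
open import Relation.Nullary.Decidable using (⌊_⌋)
open import Relation.Binary.PropositionalEquality using (_≡_; _≢_)
import Data.Fin as F
import Data.Nat as Nat

Graph : ℕ → Set
Graph n = Fin n → Fin n → Bool

IsGraph : ∀ {n} → Graph n → Set
IsGraph G = (∀ u v → G u v ≡ G v u) × (∀ u → G u u ≡ false)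

ΣFin : ∀ n → (Fin n → ℕ) → ℕ
ΣFin n f = sum (map f (allFin n))

edgeCount : ∀ {n} → Graph n → ℕ
edgeCount {n} G =
  ΣFin n (λ u → ΣFin n (λ v → if (toℕ u <ᵇ toℕ v) ∧ G u v then 1 else 0))

data Walk {n} (G : Graph n) : Fin n → Fin n → Set where
  here : ∀ {u} → Walk G u u
  step : ∀ {u v w} → G u v ≡ true → Walk G v w → Walk G u w

IsTree : ∀ {n} → Graph n → Set
IsTree {n} T = IsGraph T × (∀ u v → Walk T u v) × (edgeCount T ≡ n ∸ 1)

-- temporal graph: snapshots G 0, ..., G (L-1) (time is 0-indexed)
-- T is a spanning tree of the underlying graph (union of the snapshots)
IsSpanningTreeOfUnderlying : ∀ {n} → ℕ → (ℕ → Graph n) → Graph n → Set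
IsSpanningTreeOfUnderlying L G T =
  IsTree T × (∀ u v → T u v ≡ true → ∃ λ l → l < L × G l u v ≡ true)

missing : ∀ {n} → Graph n → Graph n → Graph n
missing T H u v = T u v ∧ not (H u v)

deficientᵇ : ∀ {n} → ℕ → Graph n → Graph n → Bool
deficientᵇ k T H = edgeCount (missing T H) ≤ᵇ k

-- Circular structure on the state set Fin N (state q here is state q+1
-- of the paper).

csuc : ∀ {m} → Fin m → Fin m
csuc {zero} ()
csuc {suc m} i with suc (toℕ i) Nat.<? suc m
... | yes p = fromℕ< p
... | no _  = fzero

_∈[_,_] : ∀ {m} → Fin m → Fin m → Fin m → Set
x ∈[ i , j ] = (toℕ i ≤ toℕ j × toℕ i ≤ toℕ x × toℕ x ≤ toℕ j)
             ⊎ (toℕ j < toℕ i × (toℕ i ≤ toℕ x ⊎ toℕ x ≤ toℕ j))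

_∈[_,_⟩ : ∀ {m} → Fin m → Fin m → Fin m → Set
x ∈[ i , j ⟩ = x ∈[ i , j ] × x ≢ j

-- DFS tour of T: a cyclic sequence v : Fin N → Fin n (v q = v_{q+1},
-- v (csuc q) = v_{q+2}, and v_{N+1} = v_1 is the root), consecutive
-- vertices adjacent in T, traversing every edge of T exactly twice.

tourEdgeIs : ∀ {n N} → (Fin N → Fin n) → Fin N → Fin n → Fin n → Bool
tourEdgeIs v q a b =
  (⌊ v q F.≟ a ⌋ ∧ ⌊ v (csuc q) F.≟ b ⌋) ∨ (⌊ v q F.≟ b ⌋ ∧ ⌊ v (csuc q) F.≟ a ⌋)

IsDFSTour : ∀ {n} → Graph n → (N : ℕ) → (Fin N → Fin n) → Set
IsDFSTour {n} T N v =
  (∀ q → T (v q) (v (csuc q)) ≡ true) ×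
  (∀ a b → T a b ≡ true →
     ΣFin N (λ q → if tourEdgeIs v q a b then 1 else 0) ≡ 2)

edgeIn : ∀ {n N} → (Fin N → Fin n) → Graph n → Fin N → Bool
edgeIn v H q = H (v q) (v (csuc q))

-- Roundabout process (agents a_p, p : Fin N, with s_p(0) = p).

move : ∀ {n N} → (Fin N → Fin n) → Graph n → (Fin N → Fin N) → (Fin N → Fin N)
move v H s p = if edgeIn v H (s p) then csuc (s p) else s p

positions : ∀ {n N} → (Fin N → Fin n) → List (Graph n) → (Fin N → Fin N)
positions v Hs = foldl (λ s H → move v H s) (λ p → p) Hs

Removable : ∀ {N} → (Fin N → Fin N) → Subset N → Fin N → Set
Removable s A p =
  ∀ x → x ∈[ p , s p ] → ∃ λ q → q ∈ A × q ≢ p × x ∈[ q , s q ]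

-- removal phase (2) with arbitrary choices: Prune s A B means B can be
-- obtained from A by removing removable agents one at a time until no
-- removable agent remains
data Prune {N} (s : Fin N → Fin N) : Subset N → Subset N → Set where
  stop   : ∀ {A} → (∀ p → p ∈ A → ¬ Removable s A p) → Prune s A A
  remove : ∀ {A B} p → p ∈ A → Removable s A p → Prune s (A - p) B → Prune s A B

data RunFrom {n N} (v : Fin N → Fin n) :
     (Fin N → Fin N) → Subset N → List (Graph n) → Subset N → Set where
  done : ∀ {s A} → RunFrom v s A [] A
  next : ∀ {s A A′ B H Hs} → Prune (move v H s) A A′ →
         RunFrom v (move v H s) A′ Hs B → RunFrom v s A (H ∷ Hs) B

Roundabout : ∀ {n N} → (Fin N → Fin n) → List (Graph n) → Subset N → Set
Roundabout v Hs B = RunFrom v (λ p → p) ⊤ Hs B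

-- t = ⌊ N / (2k) ⌋   (k ≥ 1 is assumed separately)
tVal : ℕ → ℕ → ℕ
tVal N zero    = 0
tVal N (suc k) = N / (2 * suc k)

-- expNum r J = J! · Σ_{j=0}^{J} r^j / j!  (an exact natural number)
expNum : ℕ → ℕ → ℕ
expNum r J = sum (map (λ j → r ^ j * ((J !) / (j !)) {{j !≢0}}) (upTo (suc J)))

-- e^r > M   ⇔  some partial sum of the exponential series exceeds M
ExpGt : ℕ → ℕ → Set
ExpGt r M = ∃ λ J → M * (J !) < expNum r J

-- For k ≥ 1 and ρ ≥ 1:
-- ρ ≥ 18k ln 6k ⇔ e^ρ ≥ (6k)^(18k), and equality never holds for ρ ≥ 1
-- (e^ρ is irrational), so ρ = ⌈18 k ln 6k⌉ iff ρ ≥ 1, e^ρ > (6k)^(18k)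
-- and not e^(ρ-1) > (6k)^(18k).
IsRho : ℕ → ℕ → Set
IsRho k ρ = 1 ≤ ρ × ExpGt ρ ((6 * k) ^ (18 * k))
                  × ¬ ExpGt (ρ ∸ 1) ((6 * k) ^ (18 * k))

-- Epochs. Times are 0-indexed: snapshots G 0 … G (L-1). Epoch i (i < ρ)
-- is the time interval [b i , b (suc i)), with b 0 = 0, b ρ ≤ L.

range : ℕ → ℕ → List ℕ
range lo hi = map (lo +_) (upTo (hi ∸ lo))

deficientTimes : ∀ {n} → ℕ → Graph n → (ℕ → Graph n) → ℕ → ℕ → List ℕ
deficientTimes k T G lo hi = filter (λ l → deficientᵇ k T (G l) Data.Bool.≟ true) (range lo hi)
  where import Data.Bool

epochSeq : ∀ {n} → ℕ → ℕ → ℕ → Graph n → (ℕ → Graph n) → (ℕ → ℕ) → ℕ → List (Graph n)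
epochSeq k Δ t T G b i = map G (take t (deficientTimes k T G (b i + Δ) (b (suc i))))

IsEpochSetting : ∀ {n} → ℕ → ℕ → ℕ → ℕ → ℕ → Graph n → (ℕ → Graph n) → (ℕ → ℕ) → Set
IsEpochSetting {n} k Δ t ρ L T G b =
  b 0 ≡ 0 × b ρ ≤ L × (∀ i → i < ρ → b i < b (suc i)) ×
  -- each epoch contains at least Δ + n/k deficient snapshots
  (∀ i → i < ρ → k * Δ + n ≤ k * length (deficientTimes k T G (b i) (b (suc i)))) ×
  (∀ i → i < ρ → t ≤ length (deficientTimes k T G (b i + Δ) (b (suc i))))

-- The interval family 𝓘 for U = ⋃ S^(i) = {m_1 < … < m_d}:
-- IsGap U a b holds iff (a , b) = (m_j , m_{j+1}) for some j < d or
-- (a , b) = (m_d , m_1); then I = [a , b).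
IsGap : ∀ {N} → (Fin N → Set) → Fin N → Fin N → Set
IsGap U a b =
  U a × U b ×
  ( (toℕ a < toℕ b × (∀ c → U c → ¬ (toℕ a < toℕ c × toℕ c < toℕ b)))
  ⊎ ((∀ c → U c → toℕ c ≤ toℕ a) × (∀ c → U c → toℕ b ≤ toℕ c)))

{-# OPTIONS --safe #-}
-- Throughout the roundabout process the arcs [ p , s_p ] of the active agents
-- cover the whole cycle of states. Initially every state is its own arc; a
-- move only extends an arc, and since fewer than N steps are taken
-- (t = ⌊N/2k⌋ < N) no arc ever closes up on itself; and an agent is removed
-- only when its arc is covered by the others. Of the epoch setting nothing but
-- t < N is needed. Now let [ a , c ) be a gap of 𝓘 and y the state just before
-- c. Some active agent p has y in its arc, and p, being an initial state of
-- an active agent, does not lie strictly inside the gap; so the arc from p to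
-- y passes through a, and hence contains all of [ a , c ).
module Submission where

open import Defs
open import Data.Nat using (ℕ; suc; _+_; _*_; _∸_; _⊓_; _≤_; _<_; z≤n; s≤s; s≤s⁻¹; _≤?_; _<?_)
open import Data.Nat.Properties
  using (≤-refl; ≤-trans; ≤-antisym; <⇒≤; <⇒≱; ≮⇒≥; ≰⇒>; n≮n; ≤-<-trans; ≤∧≢⇒<; n≤1+n; m≤n⇒m≤1+n;
         m≤n+m; +-comm; +-suc; +-identityʳ; +-monoˡ-<; +-cancelˡ-<; *-monoʳ-≤; ∸-monoˡ-≤; m⊓n≤m;
         module ≤-Reasoning)
open import Data.Nat.DivMod using (m/n<m)
open import Data.Fin using (Fin; toℕ; fromℕ; inject₁; _≟_)
import Data.Fin as Fin
open import Data.Fin.Properties using (toℕ<n; toℕ-fromℕ; toℕ-fromℕ<; toℕ-inject₁; toℕ-injective)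
open import Data.Fin.Subset using (Subset; _∈_; _-_)
open import Data.Fin.Subset.Properties using (∈⊤; x∈p∧x≢y⇒x∈p-y)
open import Data.List using (length; take; map; foldl)
open import Data.List.Properties using (length-map; length-take)
open import Data.Product using (∃; _×_; _,_)
open import Data.Sum using (_⊎_; inj₁; inj₂)
open import Data.Bool using (true; false)
open import Function using (_∘_)
open import Relation.Nullary using (¬_; yes; no; contradiction)
open import Relation.Binary.PropositionalEquality using (_≡_; _≢_; refl; sym; cong; subst)

-- x ∈[ i , j ] is by definition toℕ x ∈ᶜ[ toℕ i , toℕ j ].
infix 4 _∈ᶜ[_,_]
_∈ᶜ[_,_] : ℕ → ℕ → ℕ → Set
x ∈ᶜ[ i , j ] = (i ≤ j × i ≤ x × x ≤ j) ⊎ (j < i × (i ≤ x ⊎ x ≤ j))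

arc-refl : ∀ {x} → x ∈ᶜ[ x , x ]
arc-refl = inj₁ (≤-refl , ≤-refl , ≤-refl)

arc-suffix-⊆ : ∀ {p a y x} → a ∈ᶜ[ p , y ] → x ∈ᶜ[ a , y ] → x ∈ᶜ[ p , y ]
arc-suffix-⊆ (inj₁ (p≤y , p≤a , _))  (inj₁ (_ , a≤x , x≤y))  = inj₁ (p≤y , ≤-trans p≤a a≤x , x≤y)
arc-suffix-⊆ (inj₁ (_ , _ , a≤y))    (inj₂ (y<a , _))        = contradiction a≤y (<⇒≱ y<a)
arc-suffix-⊆ (inj₂ (y<p , _))        (inj₁ (_ , _ , x≤y))    = inj₂ (y<p , inj₂ x≤y)
arc-suffix-⊆ (inj₂ (y<p , inj₁ p≤a)) (inj₂ (_ , inj₁ a≤x))   = inj₂ (y<p , inj₁ (≤-trans p≤a a≤x))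
arc-suffix-⊆ (inj₂ (_ , inj₂ a≤y))   (inj₂ (y<a , inj₁ _))   = contradiction a≤y (<⇒≱ y<a)
arc-suffix-⊆ (inj₂ (y<p , _))        (inj₂ (_ , inj₂ x≤y))   = inj₂ (y<p , inj₂ x≤y)

arc-prefix-⊆ : ∀ {p y s x} → y ∈ᶜ[ p , s ] → x ∈ᶜ[ p , y ] → x ∈ᶜ[ p , s ]
arc-prefix-⊆ (inj₁ (p≤s , _ , y≤s))   (inj₁ (_ , p≤x , x≤y))  = inj₁ (p≤s , p≤x , ≤-trans x≤y y≤s)
arc-prefix-⊆ (inj₁ (_ , p≤y , _))     (inj₂ (y<p , _))        = contradiction p≤y (<⇒≱ y<p)
arc-prefix-⊆ (inj₂ (s<p , _))         (inj₁ (_ , p≤x , _))    = inj₂ (s<p , inj₁ p≤x)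
arc-prefix-⊆ (inj₂ (_ , inj₁ p≤y))    (inj₂ (y<p , _))        = contradiction p≤y (<⇒≱ y<p)
arc-prefix-⊆ (inj₂ (s<p , _))         (inj₂ (_ , inj₁ p≤x))   = inj₂ (s<p , inj₁ p≤x)
arc-prefix-⊆ (inj₂ (s<p , inj₂ y≤s))  (inj₂ (_ , inj₂ x≤y))   = inj₂ (s<p , inj₂ (≤-trans x≤y y≤s))

data CyclicSuccessor (N j : ℕ) : ℕ → Set where
  step : suc j < N → CyclicSuccessor N j (suc j)
  wrap : suc j ≡ N → CyclicSuccessor N j 0

toℕ-csuc : ∀ {N} (q : Fin N) → CyclicSuccessor N (toℕ q) (toℕ (csuc q))
toℕ-csuc {suc N} q with suc (toℕ q) <? suc N
... | yes q+1<N = subst (CyclicSuccessor (suc N) (toℕ q)) (sym (toℕ-fromℕ< q+1<N)) (step q+1<N)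
... | no  q+1≮N = wrap (≤-antisym (toℕ<n q) (≮⇒≥ q+1≮N))

cyclic-predecessor : ∀ {N} (c : Fin N) → ∃ λ (y : Fin N) → CyclicSuccessor N (toℕ y) (toℕ c)
cyclic-predecessor {suc N} Fin.zero    = fromℕ N , wrap (cong suc (toℕ-fromℕ N))
cyclic-predecessor {suc N} (Fin.suc c) =
  inject₁ c , subst (λ y → CyclicSuccessor (suc N) y (suc (toℕ c))) (sym (toℕ-inject₁ c)) (step (s≤s (toℕ<n c)))

-- Room N i j r : |[ i , j ]| + r ≤ N, so the arc [ i , j ] can be extended
-- by r more cyclic steps before it closes up.
Room : ℕ → ℕ → ℕ → ℕ → Set
Room N i j r = (i ≤ j → r + j < N + i) × (j < i → r + j < i)

room-refl : ∀ {N i r} → r < N → Room N i i r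
room-refl {i = i} r<N = (λ _ → +-monoˡ-< i r<N) , (λ i<i → contradiction i<i (n≮n i))

room-weaken : ∀ {N i j r} → Room N i j (suc r) → Room N i j r
room-weaken (inner , wrapped) = <⇒≤ ∘ inner , <⇒≤ ∘ wrapped

room-before-wrap : ∀ {i j r} → i < suc j → Room (suc j) i j (suc r) → r < i
room-before-wrap {i} {j} {r} i<1+j (inner , _) =
  +-cancelˡ-< (suc j) r i (subst (_< suc j + i) (cong suc (+-comm r j)) (inner (s≤s⁻¹ i<1+j)))

room-csuc : ∀ {N i j j′ r} → i < N → CyclicSuccessor N j j′ → Room N i j (suc r) → Room N i j′ r
room-csuc {N} {i} {j} {r = r} _ (step _) (inner , wrapped) = inner′ , wrapped′
  where
  inner′ : i ≤ suc j → r + suc j < N + i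
  inner′ _ with i ≤? j
  ... | yes i≤j = subst (_< N + i) (sym (+-suc r j)) (inner i≤j)
  ... | no  i≰j = ≤-trans (subst (_< i) (sym (+-suc r j)) (wrapped (≰⇒> i≰j))) (m≤n+m i N)
  wrapped′ : suc j < i → r + suc j < i
  wrapped′ j+1<i = subst (_< i) (sym (+-suc r j)) (wrapped (<⇒≤ j+1<i))
room-csuc {i = i} {j} {r = r} i<N (wrap refl) room =
  (λ _ → ≤-trans r<i (m≤n+m i (suc j))) , (λ _ → r<i)
  where
  r<i : r + 0 < i
  r<i = subst (_< i) (sym (+-identityʳ r)) (room-before-wrap i<N room)

∈-arc-csuc : ∀ {N i j j′ r} → i < N → CyclicSuccessor N j j′ → Room N i j (suc r) → j ∈ᶜ[ i , j′ ]
∈-arc-csuc {i = i} {j} {r = r} _ (step _) (_ , wrapped) with i ≤? j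
... | yes i≤j = inj₁ (m≤n⇒m≤1+n i≤j , i≤j , n≤1+n j)
... | no  i≰j = inj₂ (≤-<-trans (s≤s (m≤n+m j r)) (wrapped (≰⇒> i≰j)) , inj₂ (n≤1+n j))
∈-arc-csuc i<N (wrap refl) room = inj₂ (≤-<-trans z≤n (room-before-wrap i<N room) , inj₁ (s≤s⁻¹ i<N))

half-open-⊆-arc : ∀ {N y c a x} → CyclicSuccessor N y c → a < N → x < N →
                  x ∈ᶜ[ a , c ] → x ≢ c → x ∈ᶜ[ a , y ]
half-open-⊆-arc (step _) _ _ (inj₁ (_ , a≤x , x≤c)) x≢c =
  let x≤y = s≤s⁻¹ (≤∧≢⇒< x≤c x≢c) in inj₁ (≤-trans a≤x x≤y , a≤x , x≤y)
half-open-⊆-arc (step _) _ _ (inj₂ (c<a , inj₁ a≤x)) _   = inj₂ (<⇒≤ c<a , inj₁ a≤x)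
half-open-⊆-arc (step _) _ _ (inj₂ (c<a , inj₂ x≤c)) x≢c = inj₂ (<⇒≤ c<a , inj₂ (s≤s⁻¹ (≤∧≢⇒< x≤c x≢c)))
half-open-⊆-arc (wrap refl) a<N x<N (inj₂ (_ , inj₁ a≤x)) _ = inj₁ (s≤s⁻¹ a<N , a≤x , s≤s⁻¹ x<N)
half-open-⊆-arc (wrap _) _ _ (inj₁ (_ , _ , z≤n))   x≢0 = contradiction refl x≢0
half-open-⊆-arc (wrap _) _ _ (inj₂ (_ , inj₂ z≤n))  x≢0 = contradiction refl x≢0

inner-gap-start-∈-arc : ∀ {N y c a p} → CyclicSuccessor N y c → a < c → ¬ (a < p × p < c) → a ∈ᶜ[ p , y ]
inner-gap-start-∈-arc {a = a} {p} (step _) a<c p∉gap with a <? p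
... | yes a<p = inj₂ (≮⇒≥ (λ p<c → p∉gap (a<p , p<c)) , inj₂ (s≤s⁻¹ a<c))
... | no  a≮p = let p≤a = ≮⇒≥ a≮p in inj₁ (≤-trans p≤a (s≤s⁻¹ a<c) , p≤a , s≤s⁻¹ a<c)
inner-gap-start-∈-arc (wrap _) () _

outer-gap-start-∈-arc : ∀ {N y c a p} → CyclicSuccessor N y c → a < N → c ≤ p → p ≤ a → a ∈ᶜ[ p , y ]
outer-gap-start-∈-arc (step _)    _   c≤p p≤a = inj₂ (c≤p , inj₁ p≤a)
outer-gap-start-∈-arc (wrap refl) a<N _   p≤a = inj₁ (≤-trans p≤a (s≤s⁻¹ a<N) , p≤a , s≤s⁻¹ a<N)

gap-start-∈-arc : ∀ {N} {U : Fin N → Set} {a c p y : Fin N} →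
                  IsGap U a c → U p → CyclicSuccessor N (toℕ y) (toℕ c) → a ∈[ p , y ]
gap-start-∈-arc (_ , _ , inj₁ (a<c , nothing-inside)) Up y↦c =
  inner-gap-start-∈-arc y↦c a<c (nothing-inside _ Up)
gap-start-∈-arc {a = a} (_ , _ , inj₂ (below-a , above-c)) Up y↦c =
  outer-gap-start-∈-arc y↦c (toℕ<n a) (above-c _ Up) (below-a _ Up)

Covers : ∀ {N} → (Fin N → Fin N) → Subset N → Set
Covers s A = ∀ x → ∃ λ q → q ∈ A × x ∈[ q , s q ]

gap-covered : ∀ {N} {U : Fin N → Set} {B : Subset N} {s : Fin N → Fin N} {a c} →
              (∀ p → p ∈ B → U p) → Covers s B → IsGap U a c →
              ∃ λ p → p ∈ B × (∀ x → x ∈[ a , c ⟩ → x ∈[ p , s p ])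
gap-covered {s = s} {a} {c} B⊆U cov gap with cyclic-predecessor c
... | y , y↦c with cov y
...   | p , p∈B , y∈arc = p , p∈B , gap⊆arc
  where
  gap⊆arc : ∀ x → x ∈[ a , c ⟩ → x ∈[ p , s p ]
  gap⊆arc x (x∈[a,c] , x≢c) =
    arc-prefix-⊆ y∈arc
      (arc-suffix-⊆ (gap-start-∈-arc gap (B⊆U p p∈B) y↦c)
        (half-open-⊆-arc y↦c (toℕ<n a) (toℕ<n x) x∈[a,c] (x≢c ∘ toℕ-injective)))

prune-covers : ∀ {N} {s : Fin N → Fin N} {A B} → Prune s A B → Covers s A → Covers s B
prune-covers (stop _) cov = cov
prune-covers {s = s} {A} (remove p _ p-removable rest) cov = prune-covers rest cov-without-p
  where
  cov-without-p : Covers s (A - p)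
  cov-without-p x with cov x
  ... | q , q∈A , x∈arc with q ≟ p
  ...   | no  q≢p  = q , x∈p∧x≢y⇒x∈p-y q∈A q≢p , x∈arc
  ...   | yes refl with p-removable x x∈arc
  ...     | q′ , q′∈A , q′≢p , x∈arc′ = q′ , x∈p∧x≢y⇒x∈p-y q′∈A q′≢p , x∈arc′

module _ {n N : ℕ} (v : Fin N → Fin n) where

  HasRoom : (Fin N → Fin N) → ℕ → Set
  HasRoom s r = ∀ q → Room N (toℕ q) (toℕ (s q)) r

  move-room : ∀ {r} H s → HasRoom s (suc r) → HasRoom (move v H s) r
  move-room H s room q with edgeIn v H (s q)
  ... | true  = room-csuc (toℕ<n q) (toℕ-csuc (s q)) (room q)
  ... | false = room-weaken (room q)

  move-covers : ∀ {r A} H s → HasRoom s (suc r) → Covers s A → Covers (move v H s) A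
  move-covers H s room cov x with cov x
  ... | q , q∈A , x∈arc = q , q∈A , extend x∈arc
    where
    extend : x ∈[ q , s q ] → x ∈[ q , move v H s q ]
    extend x∈arc with edgeIn v H (s q)
    ... | true  = arc-prefix-⊆ (∈-arc-csuc (toℕ<n q) (toℕ-csuc (s q)) (room q)) x∈arc
    ... | false = x∈arc

  run-covers : ∀ {s A Hs B} → RunFrom v s A Hs B → HasRoom s (length Hs) → Covers s A →
               Covers (foldl (λ s H → move v H s) s Hs) B
  run-covers done _ cov = cov
  run-covers {s} (next {H = H} pruned rest) room cov =
    run-covers rest (move-room H s room) (prune-covers pruned (move-covers H s room cov))

  roundabout-covers : ∀ {Hs B} → length Hs < N → Roundabout v Hs B → Covers (positions v Hs) B
  roundabout-covers short run = run-covers run (λ _ → room-refl short) (λ x → x , ∈⊤ , arc-refl)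

length-epochSeq : ∀ {n} k Δ t T (G : ℕ → Graph n) b i → length (epochSeq k Δ t T G b i) ≤ t
length-epochSeq k Δ t T G b i = begin
  length (map G (take t times)) ≡⟨ length-map G (take t times) ⟩
  length (take t times)         ≡⟨ length-take t times ⟩
  t ⊓ length times              ≤⟨ m⊓n≤m t (length times) ⟩
  t                             ∎
  where
  open ≤-Reasoning
  times = deficientTimes k T G (b i + Δ) (b (suc i))

tVal-< : ∀ {N k} → 0 < N → 1 ≤ k → tVal N k < N
tVal-< {suc N} {suc k} _ _ = m/n<m (suc N) (2 * suc k) (*-monoʳ-≤ 2 (s≤s z≤n))

lemma11 :
    (n k Δ : ℕ) → 2 ≤ n → 1 ≤ k →
    (L : ℕ) (G : ℕ → Graph n) → (∀ l → l < L → IsGraph (G l)) →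
    (T : Graph n) → IsSpanningTreeOfUnderlying L G T →
    (v : Fin (2 * (n ∸ 1)) → Fin n) → IsDFSTour T (2 * (n ∸ 1)) v →
    (ρ : ℕ) → IsRho k ρ →
    (b : ℕ → ℕ) → IsEpochSetting k Δ (tVal (2 * (n ∸ 1)) k) ρ L T G b →
    (A : ℕ → Subset (2 * (n ∸ 1))) →
    (∀ i → i < ρ → Roundabout v (epochSeq k Δ (tVal (2 * (n ∸ 1)) k) T G b i) (A i)) →
    ∀ i → i < ρ →
    ∀ a c → IsGap (λ m → ∃ λ j → j < ρ × m ∈ A j) a c →
    ∃ λ p → p ∈ A i ×
      (∀ x → x ∈[ a , c ⟩ →
         x ∈[ p , positions v (epochSeq k Δ (tVal (2 * (n ∸ 1)) k) T G b i) p ])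
lemma11 n k Δ n≥2 k≥1 L G _ T _ v _ ρ _ b _ A roundabout i i<ρ a c gap =
  gap-covered (λ p p∈Aᵢ → i , i<ρ , p∈Aᵢ) (roundabout-covers v epoch-short (roundabout i i<ρ)) gap
  where
  N = 2 * (n ∸ 1)
  t = tVal N k
  N>0 : 0 < N
  N>0 = ≤-trans (s≤s z≤n) (*-monoʳ-≤ 2 (∸-monoˡ-≤ 1 n≥2))
  epoch-short : length (epochSeq k Δ t T G b i) < N
  epoch-short = ≤-<-trans (length-epochSeq k Δ t T G b i) (tVal-< N>0 k≥1)
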